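{- In the setting of the context, if $p_{2m+1}<p_1-p_m$, then $C_m^{LPT}/C_m^*\le\frac{15}{13}$ for $m=3$ and $C_m^{LPT}/C_m^*\le\frac{4}{3}-\frac{1}{2m-1}$ for $m\ge4$.
   Context: Problem $P_m\|C_{max}$ with $m\ge3$ identical machines and $n=2m+1$ jobs with processing times $p_1\ge p_2\ge\dots\ge p_{2m+1}\ge0$; the makespan is the maximum machine load and $C_m^*$ is the optimal makespan. LPT assigns jobs one at a time in order $1,\dots,n$ to a machine with currently smallest load; $C_m^{LPT}$ is its makespan. It is assumed that, in the LPT schedule, for each $i=1,\dots,m$ jobs $i$ and $2m+1-i$ are assigned to the same machine before job $2m+1$ is assigned, and that job $2m+1$ is the critical job (the last job on a machine whose load equals the LPT makespan).
   Formalization: The processing times of the jobs are rational numbers. -}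

module Defs where

open import Data.Nat as ℕ using (ℕ; zero; suc)
open import Data.Fin using (Fin; zero; suc; toℕ; fromℕ<)
open import Data.Fin.Properties using () renaming (_≟_ to _≟ᶠ_)
open import Data.Integer using (+_)
open import Data.Rational using (ℚ; 0ℚ; _+_; _-_; _*_; _≤_; _<_; _⊔_; _/_)
open import Relation.Nullary.Decidable using (⌊_⌋)
open import Data.Bool using (if_then_else_)

∑ : ∀ {n} → (Fin n → ℚ) → ℚ
∑ {zero}  f = 0ℚ
∑ {suc n} f = f zero + ∑ (λ i → f (suc i))

-- Finite maximum of rationals over Fin n (0 for the empty index set;
-- loads are nonnegative so this is the usual maximum when n ≥ 1).
maxF : ∀ {n} → (Fin n → ℚ) → ℚ
maxF {zero}  f = 0ℚ
maxF {suc n} f = f zero ⊔ maxF (λ i → f (suc i))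

-- Jobs are indexed by Fin n (job j+1 of the paper is index j),
-- machines by Fin m.  A schedule assigns each job to a machine.
Schedule : ℕ → ℕ → Set
Schedule n m = Fin n → Fin m

load : ∀ {n m} → (Fin n → ℚ) → Schedule n m → Fin m → ℚ
load p σ k = ∑ (λ j → if ⌊ σ j ≟ᶠ k ⌋ then p j else 0ℚ)

loadBefore : ∀ {n m} → (Fin n → ℚ) → Schedule n m → Fin n → Fin m → ℚ
loadBefore p σ j k =
  ∑ (λ j' → if ⌊ σ j' ≟ᶠ k ⌋ then (if ⌊ toℕ j' ℕ.<? toℕ j ⌋ then p j' else 0ℚ) else 0ℚ)

makespan : ∀ {n m} → (Fin n → ℚ) → Schedule n m → ℚ
makespan p σ = maxF (load p σ)

-- σ is an LPT schedule: jobs are processed in index order (jobs are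
-- sorted nonincreasingly by the hypotheses) and each job goes to a
-- machine whose current load is smallest (ties broken arbitrarily).
IsLPT : ∀ {n m} → (Fin n → ℚ) → Schedule n m → Set
IsLPT p σ = ∀ j k → loadBefore p σ j (σ j) ≤ loadBefore p σ j k

-- 4/3 - 1/(2m-1), written for m = suc k (so 2m-1 = suc (2k)).
boundLarge : ℕ → ℚ
boundLarge zero    = + 4 / 3
boundLarge (suc k) = + 4 / 3 - + 1 / suc (2 ℕ.* k)

open import Data.Fin using (inject≤; inject₁; opposite; fromℕ)
open import Data.Nat.Properties using (m≤m+n; ≤-trans; n≤1+n)

private
  m≤2m : ∀ m → m ℕ.≤ 2 ℕ.* m
  m≤2m m = m≤m+n m (m ℕ.+ 0)

  m≤2m+1 : ∀ m → m ℕ.≤ suc (2 ℕ.* m)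
  m≤2m+1 m = ≤-trans (m≤2m m) (n≤1+n _)

-- Paper's job i, for i = 1..m (given as i-1 : Fin m).
jobLow : ∀ m → Fin m → Fin (suc (2 ℕ.* m))
jobLow m i = inject≤ i (m≤2m+1 m)

-- Paper's job 2m+1-i, for i = 1..m (given as i-1 : Fin m): index 2m-i.
jobHigh : ∀ m → Fin m → Fin (suc (2 ℕ.* m))
jobHigh m i = inject₁ (opposite (inject≤ i (m≤2m m)))

job1 : ∀ m → Fin (suc (2 ℕ.* m))
job1 m = zero

-- Paper's job m (meaningful for m ≥ 1).
jobM : ∀ m → Fin (suc (2 ℕ.* m))
jobM zero    = zero
jobM (suc k) = jobLow (suc k) (fromℕ k)

jobLast : ∀ m → Fin (suc (2 ℕ.* m))
jobLast m = fromℕ (2 ℕ.* m)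

module Submission where

-- Let L be the start time of the last job 2m+1 in the LPT schedule, so that C^LPT = L + p_{2m+1},
-- and let C be the makespan of an arbitrary schedule.
--  (A) L is the smallest machine load before job 2m+1, so m L + p_{2m+1} ≤ ∑ p ≤ m C.
--  (B) If p_m > 0, LPT puts jobs 1, …, m on distinct machines, so just before job 2m+1 each machine
--      holds exactly one pair {i, 2m+1-i}.  Hence L ≤ p_m + p_{m+1} ≤ 2 p_m < 2 (p_1 - p_{2m+1}), and
--      counting the machine of jobs 1 and 2m apart from the others gives (2m-1) L + 6 p_{2m+1} ≤ 2m C.
--      If p_m = 0 then p_{2m+1} = 0 and (B) already follows from (A).
--  (C) With 2m+1 jobs some machine receives three of them, so 3 p_{2m+1} ≤ C.
-- For m = 3, 2 (B) + (A) reads 13 C^LPT ≤ 15 C; for m ≥ 4, 3 (B) + (2m-7) (C) reads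
-- 3 (2m-1) C^LPT ≤ (8m-7) C.

open import Defs
open import Data.Nat as ℕ using (ℕ; suc)
open import Data.Fin using (Fin; toℕ)
open import Data.Integer using (+_)
open import Data.Rational using (ℚ; 0ℚ; _-_; _*_; _≤_; _<_; _/_)
open import Data.Product using (_×_)
open import Relation.Binary.PropositionalEquality using (_≡_)

open import Algebra.Bundles using (CommutativeMonoid)
open import Data.Bool using (true; false; if_then_else_)
open import Data.Empty using (⊥-elim)
open import Data.Nat using (zero)
open import Data.Fin as Fin using (zero; suc; inject₁; fromℕ; fromℕ<; combine; opposite)
open import Data.Fin.Properties
  using (toℕ<n; toℕ-inject₁; toℕ-inject≤; toℕ-fromℕ; toℕ-fromℕ<; toℕ-injective; fromℕ<-injective;
         opposite-prop; combine-injective; pigeonhole; any?; ¬∀⟶∃¬)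
  renaming (_≟_ to _≟ᶠ_)
import Data.Fin.Properties as Finₚ
import Data.Integer as ℤ
import Data.Integer.Properties as ℤₚ
import Data.Nat.Properties as ℕₚ
open import Data.Product using (∃; ∃-syntax; _,_; proj₁; proj₂)
open import Data.Rational using (1ℚ; _+_; -_; positive; nonNegative; toℚᵘ)
open import Data.Rational.Properties
open import Data.Rational.Solver using (module +-*-Solver)
import Data.Rational.Unnormalised as ℚᵘ
import Data.Rational.Unnormalised.Properties as ℚᵘ
open import Data.Sum using (_⊎_; inj₁; inj₂)
open import Data.Vec.Functional using (updateAt)
open import Data.Vec.Functional.Properties using (updateAt-updates; updateAt-minimal)
open import Function using (_∘_; const)
open import Relation.Binary.Definitions using (tri<; tri≈; tri>)
open import Relation.Binary.PropositionalEquality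
  using (refl; sym; trans; cong; cong₂; subst; subst₂; _≢_; _≗_; module ≡-Reasoning)
open import Relation.Nullary using (Dec; yes; no; ¬_)
open import Relation.Nullary.Decidable using (⌊_⌋; _×-dec_)

open import Algebra.Properties.CommutativeSemigroup
  (CommutativeMonoid.commutativeSemigroup +-0-commutativeMonoid) using (interchange; x∙yz≈y∙xz)
open +-*-Solver

-- The natural numbers inside ℚ; unlike + n / 1 it unfolds by recursion on n.
toℚ : ℕ → ℚ
toℚ zero    = 0ℚ
toℚ (suc n) = 1ℚ + toℚ n

toℚ-nonNeg : ∀ n → 0ℚ ≤ toℚ n
toℚ-nonNeg zero    = ≤-refl
toℚ-nonNeg (suc n) = +-mono-≤ (nonNegative⁻¹ 1ℚ) (toℚ-nonNeg n)

toℚ-suc-pos : ∀ n → 0ℚ < toℚ (suc n)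
toℚ-suc-pos n = <-≤-trans (positive⁻¹ 1ℚ)
  (≤-trans (≤-reflexive (sym (+-identityʳ 1ℚ))) (+-monoʳ-≤ 1ℚ (toℚ-nonNeg n)))

toℚ-+ : ∀ a b → toℚ (a ℕ.+ b) ≡ toℚ a + toℚ b
toℚ-+ zero    b = sym (+-identityˡ (toℚ b))
toℚ-+ (suc a) b = trans (cong (_+_ 1ℚ) (toℚ-+ a b)) (sym (+-assoc 1ℚ (toℚ a) (toℚ b)))

toℚ-mono-≤ : ∀ {a b} → a ℕ.≤ b → toℚ a ≤ toℚ b
toℚ-mono-≤ {b = b} ℕ.z≤n = toℚ-nonNeg b
toℚ-mono-≤ (ℕ.s≤s a≤b) = +-monoʳ-≤ 1ℚ (toℚ-mono-≤ a≤b)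

toℚᵘ-toℚ : ∀ n → toℚᵘ (toℚ n) ℚᵘ.≃ ℚᵘ.mkℚᵘ (+ n) 0
toℚᵘ-toℚ zero    = ℚᵘ.≃-refl
toℚᵘ-toℚ (suc n) = ℚᵘ.≃-trans (toℚᵘ-homo-+ 1ℚ (toℚ n))
  (ℚᵘ.≃-trans (ℚᵘ.+-cong (ℚᵘ.≃-refl {ℚᵘ.1ℚᵘ}) (toℚᵘ-toℚ n))
              (ℚᵘ.*≡* (cong (λ z → (+ 1 ℤ.+ z) ℤ.* + 1) (ℤₚ.*-identityʳ (+ n)))))

toℚ-suc-reciprocal : ∀ n → (+ 1 / suc n) * toℚ (suc n) ≡ 1ℚ
toℚ-suc-reciprocal n = toℚᵘ-injective (ℚᵘ.≃-trans (toℚᵘ-homo-* (+ 1 / suc n) (toℚ (suc n)))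
  (ℚᵘ.≃-trans (ℚᵘ.*-cong (toℚᵘ-fromℚᵘ (ℚᵘ.mkℚᵘ (+ 1) n)) (toℚᵘ-toℚ (suc n)))
              (ℚᵘ.*-inverseˡ (ℚᵘ.mkℚᵘ (+ suc n) 0))))

toℚ-suc-* : ∀ n c → toℚ (suc n) * c ≡ c + toℚ n * c
toℚ-suc-* n c = trans (*-distribʳ-+ c 1ℚ (toℚ n)) (cong (_+ toℚ n * c) (*-identityˡ c))

-- Finite sums

∑-cong : ∀ {n} {f g : Fin n → ℚ} → f ≗ g → ∑ f ≡ ∑ g
∑-cong {zero}  f≗g = refl
∑-cong {suc n} f≗g = cong₂ _+_ (f≗g zero) (∑-cong (f≗g ∘ suc))

∑-mono-≤ : ∀ {n} {f g : Fin n → ℚ} → (∀ i → f i ≤ g i) → ∑ f ≤ ∑ g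
∑-mono-≤ {zero}  f≤g = ≤-refl
∑-mono-≤ {suc n} f≤g = +-mono-≤ (f≤g zero) (∑-mono-≤ (f≤g ∘ suc))

∑-zero : ∀ {n} {f : Fin n → ℚ} → (∀ i → f i ≡ 0ℚ) → ∑ f ≡ 0ℚ
∑-zero {zero}  f≡0 = refl
∑-zero {suc n} f≡0 = trans (cong₂ _+_ (f≡0 zero) (∑-zero (f≡0 ∘ suc))) (+-identityˡ 0ℚ)

∑-nonNeg : ∀ {n} {f : Fin n → ℚ} → (∀ i → 0ℚ ≤ f i) → 0ℚ ≤ ∑ f
∑-nonNeg {n} 0≤f = ≤-trans (≤-reflexive (sym (∑-zero {n} {const 0ℚ} (λ _ → refl)))) (∑-mono-≤ 0≤f)

∑-distrib-+ : ∀ {n} (f g : Fin n → ℚ) → ∑ (λ i → f i + g i) ≡ ∑ f + ∑ g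
∑-distrib-+ {zero}  f g = sym (+-identityˡ 0ℚ)
∑-distrib-+ {suc n} f g =
  trans (cong (_+_ (f zero + g zero)) (∑-distrib-+ (f ∘ suc) (g ∘ suc)))
        (interchange (f zero) (g zero) (∑ (f ∘ suc)) (∑ (g ∘ suc)))

∑-comm : ∀ {m n} (G : Fin m → Fin n → ℚ) → ∑ (λ i → ∑ (G i)) ≡ ∑ (λ j → ∑ (λ i → G i j))
∑-comm {zero}  {n} G = sym (∑-zero {n} (λ _ → refl))
∑-comm {suc m}     G = trans (cong (_+_ (∑ (G zero))) (∑-comm (G ∘ suc))) (sym (∑-distrib-+ (G zero) _))

∑-init-last : ∀ {n} (f : Fin (suc n) → ℚ) → ∑ f ≡ ∑ (f ∘ inject₁) + f (fromℕ n)
∑-init-last {zero}  f = trans (+-identityʳ (f zero)) (sym (+-identityˡ (f zero)))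
∑-init-last {suc n} f = trans (cong (_+_ (f zero)) (∑-init-last (f ∘ suc))) (sym (+-assoc (f zero) _ _))

∑-≤-const : ∀ {n} {f : Fin n → ℚ} {c} → (∀ i → f i ≤ c) → ∑ f ≤ toℚ n * c
∑-≤-const {zero}      {c = c} f≤c = ≤-reflexive (sym (*-zeroˡ c))
∑-≤-const {suc n} {f} {c}     f≤c = begin
  ∑ f                   ≤⟨ +-mono-≤ (f≤c zero) (∑-≤-const (f≤c ∘ suc)) ⟩
  c + toℚ n * c         ≡⟨ toℚ-suc-* n c ⟨
  toℚ (suc n) * c       ∎
  where open ≤-Reasoning

∑-≥-const : ∀ {n} {f : Fin n → ℚ} {c} → (∀ i → c ≤ f i) → toℚ n * c ≤ ∑ f
∑-≥-const {zero}      {c = c} c≤f = ≤-reflexive (*-zeroˡ c)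
∑-≥-const {suc n} {f} {c}     c≤f = begin
  toℚ (suc n) * c   ≡⟨ toℚ-suc-* n c ⟩
  c + toℚ n * c     ≤⟨ +-mono-≤ (c≤f zero) (∑-≥-const (c≤f ∘ suc)) ⟩
  ∑ f               ∎
  where open ≤-Reasoning

∑-≥-at+const : ∀ {n} {f : Fin (suc n) → ℚ} {c} → (∀ i → c ≤ f i) → ∀ i → f i + toℚ n * c ≤ ∑ f
∑-≥-at+const {f = f} c≤f zero = +-monoʳ-≤ (f zero) (∑-≥-const (c≤f ∘ suc))
∑-≥-at+const {suc n} {f} {c} c≤f (suc i) = begin
  f (suc i) + toℚ (suc n) * c   ≡⟨ cong (_+_ (f (suc i))) (toℚ-suc-* n c) ⟩
  f (suc i) + (c + toℚ n * c)   ≡⟨ x∙yz≈y∙xz (f (suc i)) c (toℚ n * c) ⟩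
  c + (f (suc i) + toℚ n * c)   ≤⟨ +-mono-≤ (c≤f zero) (∑-≥-at+const (c≤f ∘ suc) i) ⟩
  ∑ f                           ∎
  where open ≤-Reasoning

zeroAt : ∀ {n} → (Fin n → ℚ) → Fin n → Fin n → ℚ
zeroAt f i = updateAt f i (const 0ℚ)

zeroAt-other : ∀ {n} (f : Fin n → ℚ) {i j} → i ≢ j → zeroAt f i j ≡ f j
zeroAt-other f {i} {j} i≢j = updateAt-minimal j i f (i≢j ∘ sym)

zeroAt-vanish : ∀ {n} (f : Fin n → ℚ) {i j} → (i ≢ j → f j ≡ 0ℚ) → zeroAt f i j ≡ 0ℚ
zeroAt-vanish f {i} {j} f≡0 with i ≟ᶠ j
... | yes refl = updateAt-updates i f
... | no i≢j   = trans (zeroAt-other f i≢j) (f≡0 i≢j)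

zeroAt-nonNeg : ∀ {n} {f : Fin n → ℚ} → (∀ j → 0ℚ ≤ f j) → ∀ i j → 0ℚ ≤ zeroAt f i j
zeroAt-nonNeg {f = f} 0≤f i j with i ≟ᶠ j
... | yes refl = ≤-reflexive (sym (updateAt-updates i f))
... | no i≢j   = ≤-trans (0≤f j) (≤-reflexive (sym (zeroAt-other f i≢j)))

∑-zeroAt : ∀ {n} (f : Fin n → ℚ) i → ∑ f ≡ f i + ∑ (zeroAt f i)
∑-zeroAt f zero    = cong (_+_ (f zero)) (sym (+-identityˡ _))
∑-zeroAt f (suc i) = trans (cong (_+_ (f zero)) (∑-zeroAt (f ∘ suc) i))
  (x∙yz≈y∙xz (f zero) (f (suc i)) _)

∑-≥-one : ∀ {n} {f : Fin n → ℚ} → (∀ j → 0ℚ ≤ f j) → ∀ i → f i ≤ ∑ f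
∑-≥-one {f = f} 0≤f i = begin
  f i                       ≡⟨ +-identityʳ (f i) ⟨
  f i + 0ℚ                  ≤⟨ +-monoʳ-≤ (f i) (∑-nonNeg (zeroAt-nonNeg 0≤f i)) ⟩
  f i + ∑ (zeroAt f i)      ≡⟨ ∑-zeroAt f i ⟨
  ∑ f                       ∎
  where open ≤-Reasoning

∑-≥-two : ∀ {n} {f : Fin n → ℚ} → (∀ j → 0ℚ ≤ f j) → ∀ {i j} → i ≢ j → f i + f j ≤ ∑ f
∑-≥-two {f = f} 0≤f {i} {j} i≢j = begin
  f i + f j                 ≡⟨ cong (_+_ (f i)) (zeroAt-other f i≢j) ⟨
  f i + zeroAt f i j        ≤⟨ +-monoʳ-≤ (f i) (∑-≥-one (zeroAt-nonNeg 0≤f i) j) ⟩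
  f i + ∑ (zeroAt f i)      ≡⟨ ∑-zeroAt f i ⟨
  ∑ f                       ∎
  where open ≤-Reasoning

∑-≥-three : ∀ {n} {f : Fin n → ℚ} → (∀ j → 0ℚ ≤ f j) →
            ∀ {i j k} → i ≢ j → i ≢ k → j ≢ k → f i + (f j + f k) ≤ ∑ f
∑-≥-three {f = f} 0≤f {i} {j} {k} i≢j i≢k j≢k = begin
  f i + (f j + f k)                   ≡⟨ cong (_+_ (f i)) (cong₂ _+_ (zeroAt-other f i≢j)
                                                                   (zeroAt-other f i≢k)) ⟨
  f i + (zeroAt f i j + zeroAt f i k) ≤⟨ +-monoʳ-≤ (f i) (∑-≥-two (zeroAt-nonNeg 0≤f i) j≢k) ⟩
  f i + ∑ (zeroAt f i)                ≡⟨ ∑-zeroAt f i ⟨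
  ∑ f                                 ∎
  where open ≤-Reasoning

∑-≡-one : ∀ {n} {f : Fin n → ℚ} i → (∀ j → j ≢ i → f j ≡ 0ℚ) → ∑ f ≡ f i
∑-≡-one {f = f} i f≡0 = begin
  ∑ f                    ≡⟨ ∑-zeroAt f i ⟩
  f i + ∑ (zeroAt f i)   ≡⟨ cong (_+_ (f i)) (∑-zero (λ j → zeroAt-vanish f (λ i≢j → f≡0 j (i≢j ∘ sym)))) ⟩
  f i + 0ℚ               ≡⟨ +-identityʳ (f i) ⟩
  f i                    ∎
  where open ≡-Reasoning

∑-≡-two : ∀ {n} {f : Fin n → ℚ} {i j} → i ≢ j → (∀ l → l ≢ i → l ≢ j → f l ≡ 0ℚ) → ∑ f ≡ f i + f j
∑-≡-two {f = f} {i} {j} i≢j f≡0 = begin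
  ∑ f                    ≡⟨ ∑-zeroAt f i ⟩
  f i + ∑ (zeroAt f i)   ≡⟨ cong (_+_ (f i))
                              (∑-≡-one j (λ l l≢j → zeroAt-vanish f (λ i≢l → f≡0 l (i≢l ∘ sym) l≢j))) ⟩
  f i + zeroAt f i j     ≡⟨ cong (_+_ (f i)) (zeroAt-other f i≢j) ⟩
  f i + f j              ∎
  where open ≡-Reasoning

maxF-upper : ∀ {n} (f : Fin n → ℚ) i → f i ≤ maxF f
maxF-upper f zero    = p≤p⊔q (f zero) _
maxF-upper f (suc i) = ≤-trans (maxF-upper (f ∘ suc) i) (p≤q⊔p (f zero) _)

if-nonNeg : ∀ b {x} → 0ℚ ≤ x → 0ℚ ≤ (if b then x else 0ℚ)
if-nonNeg true  0≤x = 0≤x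
if-nonNeg false _   = ≤-refl

if-dec-true : ∀ {A : Set} (a? : Dec A) {x y : ℚ} → A → (if ⌊ a? ⌋ then x else y) ≡ x
if-dec-true (yes _) _ = refl
if-dec-true (no ¬a) a = ⊥-elim (¬a a)

if-dec-false : ∀ {A : Set} (a? : Dec A) {x y : ℚ} → ¬ A → (if ⌊ a? ⌋ then x else y) ≡ y
if-dec-false (yes a) ¬a = ⊥-elim (¬a a)
if-dec-false (no _)  _  = refl

-- Loads of a schedule

onMachine : ∀ {n m} → (Fin n → ℚ) → Schedule n m → Fin m → Fin n → ℚ
onMachine p σ k j = if ⌊ σ j ≟ᶠ k ⌋ then p j else 0ℚ

module _ {n m} (p : Fin n → ℚ) (σ : Schedule n m) where

  onMachine-on : ∀ {k j} → σ j ≡ k → onMachine p σ k j ≡ p j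
  onMachine-on {k} {j} = if-dec-true (σ j ≟ᶠ k)

  onMachine-off : ∀ {k j} → σ j ≢ k → onMachine p σ k j ≡ 0ℚ
  onMachine-off {k} {j} = if-dec-false (σ j ≟ᶠ k)

  onMachine-vanish : ∀ {k j} → (σ j ≡ k → p j ≡ 0ℚ) → onMachine p σ k j ≡ 0ℚ
  onMachine-vanish {k} {j} p≡0 with σ j ≟ᶠ k
  ... | yes σj≡k = p≡0 σj≡k
  ... | no _     = refl

  ∑-onMachine : ∀ j → ∑ (λ k → onMachine p σ k j) ≡ p j
  ∑-onMachine j = trans (∑-≡-one (σ j) (λ k k≢σj → onMachine-off (k≢σj ∘ sym))) (onMachine-on refl)

  ∑-load : ∑ (load p σ) ≡ ∑ p
  ∑-load = trans (∑-comm (onMachine p σ)) (∑-cong ∑-onMachine)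

  module _ (0≤p : ∀ j → 0ℚ ≤ p j) where

    onMachine-nonNeg : ∀ k j → 0ℚ ≤ onMachine p σ k j
    onMachine-nonNeg k j = if-nonNeg _ (0≤p j)

    load-≥-one : ∀ {k j} → σ j ≡ k → p j ≤ load p σ k
    load-≥-one {k} {j} σj≡k =
      ≤-trans (≤-reflexive (sym (onMachine-on σj≡k))) (∑-≥-one (onMachine-nonNeg k) j)

    load-≥-two : ∀ {k j j′} → j ≢ j′ → σ j ≡ k → σ j′ ≡ k → p j + p j′ ≤ load p σ k
    load-≥-two {k} j≢j′ σj≡k σj′≡k = ≤-trans
      (≤-reflexive (sym (cong₂ _+_ (onMachine-on σj≡k) (onMachine-on σj′≡k))))
      (∑-≥-two (onMachine-nonNeg k) j≢j′)

    load-≥-three : ∀ {k i j l} → i ≢ j → i ≢ l → j ≢ l → σ i ≡ k → σ j ≡ k → σ l ≡ k →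
                   p i + (p j + p l) ≤ load p σ k
    load-≥-three {k} i≢j i≢l j≢l σi≡k σj≡k σl≡k = ≤-trans
      (≤-reflexive (sym (cong₂ _+_ (onMachine-on σi≡k) (cong₂ _+_ (onMachine-on σj≡k) (onMachine-on σl≡k)))))
      (∑-≥-three (onMachine-nonNeg k) i≢j i≢l j≢l)

  load-≡-zero : ∀ {k} → (∀ j → σ j ≡ k → p j ≡ 0ℚ) → load p σ k ≡ 0ℚ
  load-≡-zero p≡0 = ∑-zero (λ j → onMachine-vanish (p≡0 j))

  load-≡-two : ∀ {k j j′} → j ≢ j′ → σ j ≡ k → σ j′ ≡ k →
             (∀ l → l ≢ j → l ≢ j′ → σ l ≡ k → p l ≡ 0ℚ) → load p σ k ≡ p j + p j′
  load-≡-two j≢j′ σj≡k σj′≡k p≡0 = trans (∑-≡-two j≢j′ (λ l l≢j l≢j′ → onMachine-vanish (p≡0 l l≢j l≢j′)))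
    (cong₂ _+_ (onMachine-on σj≡k) (onMachine-on σj′≡k))

  load≤makespan : ∀ k → load p σ k ≤ makespan p σ
  load≤makespan = maxF-upper (load p σ)

makespan-nonNeg : ∀ {n m} (p : Fin n → ℚ) (τ : Schedule n (suc m)) → (∀ j → 0ℚ ≤ p j) → 0ℚ ≤ makespan p τ
makespan-nonNeg p τ 0≤p = ≤-trans (∑-nonNeg (onMachine-nonNeg p τ 0≤p zero)) (load≤makespan p τ zero)

timesBefore : ∀ {n} → (Fin n → ℚ) → Fin n → Fin n → ℚ
timesBefore p J j = if ⌊ toℕ j ℕ.<? toℕ J ⌋ then p j else 0ℚ

-- loadBefore p σ J is, by definition, load (timesBefore p J) σ.
module _ {n} (p : Fin n → ℚ) (J : Fin n) where

  timesBefore-earlier : ∀ {j} → toℕ j ℕ.< toℕ J → timesBefore p J j ≡ p j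
  timesBefore-earlier {j} = if-dec-true (toℕ j ℕ.<? toℕ J)

  timesBefore-later : ∀ {j} → ¬ toℕ j ℕ.< toℕ J → timesBefore p J j ≡ 0ℚ
  timesBefore-later {j} = if-dec-false (toℕ j ℕ.<? toℕ J)

  timesBefore-nonNeg : (∀ j → 0ℚ ≤ p j) → ∀ j → 0ℚ ≤ timesBefore p J j
  timesBefore-nonNeg 0≤p j = if-nonNeg _ (0≤p j)

inject₁<fromℕ : ∀ {N} (j : Fin N) → toℕ (inject₁ j) ℕ.< toℕ (fromℕ N)
inject₁<fromℕ {N} j = subst₂ ℕ._<_ (sym (toℕ-inject₁ j)) (sym (toℕ-fromℕ N)) (toℕ<n j)

module _ {N m} (p : Fin (suc N) → ℚ) (σ : Schedule (suc N) m) where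

  load-split-last : ∀ k → load p σ k ≡ loadBefore p σ (fromℕ N) k + onMachine p σ k (fromℕ N)
  load-split-last k = begin
    load p σ k                                             ≡⟨ ∑-init-last (onMachine p σ k) ⟩
    ∑ (onMachine p σ k ∘ inject₁) + onMachine p σ k last   ≡⟨ cong (_+ onMachine p σ k last) earlier ⟩
    loadBefore p σ last k + onMachine p σ k last           ∎
    where
    open ≡-Reasoning
    last : Fin (suc N)
    last = fromℕ N
    p′ : Fin (suc N) → ℚ
    p′ = timesBefore p last
    earlier : ∑ (onMachine p σ k ∘ inject₁) ≡ loadBefore p σ last k
    earlier = begin
      ∑ (onMachine p σ k ∘ inject₁)                          ≡⟨ ∑-cong (cong (if _ then_else 0ℚ) ∘ p≡p′) ⟩
      ∑ (onMachine p′ σ k ∘ inject₁)                         ≡⟨ +-identityʳ _ ⟨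
      ∑ (onMachine p′ σ k ∘ inject₁) + 0ℚ                    ≡⟨ cong (_+_ (∑ (onMachine p′ σ k ∘ inject₁))) p′-last ⟨
      ∑ (onMachine p′ σ k ∘ inject₁) + onMachine p′ σ k last ≡⟨ ∑-init-last (onMachine p′ σ k) ⟨
      loadBefore p σ last k                                  ∎
      where
      p≡p′ : ∀ j → p (inject₁ j) ≡ p′ (inject₁ j)
      p≡p′ j = sym (timesBefore-earlier p last (inject₁<fromℕ j))
      p′-last : onMachine p′ σ k last ≡ 0ℚ
      p′-last = onMachine-vanish p′ σ (λ _ → timesBefore-later p last (ℕₚ.n≮n _))

  load-lastMachine : load p σ (σ (fromℕ N)) ≡ loadBefore p σ (fromℕ N) (σ (fromℕ N)) + p (fromℕ N)
  load-lastMachine = trans (load-split-last (σ (fromℕ N)))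
    (cong (_+_ (loadBefore p σ (fromℕ N) (σ (fromℕ N)))) (onMachine-on p σ refl))

  ∑-loadBefore-last : ∑ (loadBefore p σ (fromℕ N)) + p (fromℕ N) ≡ ∑ p
  ∑-loadBefore-last = begin
    ∑ (loadBefore p σ last) + p last
      ≡⟨ cong (_+_ (∑ (loadBefore p σ last))) (∑-onMachine p σ last) ⟨
    ∑ (loadBefore p σ last) + ∑ (λ k → onMachine p σ k last)
      ≡⟨ ∑-distrib-+ (loadBefore p σ last) (λ k → onMachine p σ k last) ⟨
    ∑ (λ k → loadBefore p σ last k + onMachine p σ k last)   ≡⟨ ∑-cong load-split-last ⟨
    ∑ (load p σ)                                             ≡⟨ ∑-load p σ ⟩
    ∑ p                                                      ∎
    where
    open ≡-Reasoning
    last : Fin (suc N)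
    last = fromℕ N

  total-work : (τ : Schedule (suc N) m) → ∑ (loadBefore p σ (fromℕ N)) + p (fromℕ N) ≤ toℚ m * makespan p τ
  total-work τ = begin
    ∑ (loadBefore p σ (fromℕ N)) + p (fromℕ N)   ≡⟨ ∑-loadBefore-last ⟩
    ∑ p                                           ≡⟨ ∑-load p τ ⟨
    ∑ (load p τ)                                  ≤⟨ ∑-≤-const (load≤makespan p τ) ⟩
    toℚ m * makespan p τ                          ∎
    where open ≤-Reasoning

  lpt-average : IsLPT p σ → (τ : Schedule (suc N) m) →
    toℚ m * loadBefore p σ (fromℕ N) (σ (fromℕ N)) + p (fromℕ N) ≤ toℚ m * makespan p τ
  lpt-average lpt τ = ≤-trans (+-monoˡ-≤ (p (fromℕ N)) (∑-≥-const (lpt (fromℕ N)))) (total-work τ)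

-- Longest processing time first

module _ {n m} (p : Fin n → ℚ) (σ : Schedule n m) (lpt : IsLPT p σ) where

  lpt-empty-machine : ∀ J → toℕ J ℕ.< m → loadBefore p σ J (σ J) ≤ 0ℚ
  lpt-empty-machine J J<m = ≤-trans (lpt J (proj₁ empty-machine)) (≤-reflexive (load-≡-zero (timesBefore p J) σ
      (λ j σj≡k → timesBefore-later p J (λ j<J → proj₂ empty-machine (j , j<J , σj≡k)))))
    where
    Occupied : Fin m → Set
    Occupied k = ∃ λ j → toℕ j ℕ.< toℕ J × σ j ≡ k

    not-all-occupied : ¬ (∀ k → Occupied k)
    not-all-occupied occ with k₁ , k₂ , k₁<k₂ , same ← pigeonhole J<m (λ k → fromℕ< (proj₁ (proj₂ (occ k)))) =
      Finₚ.<⇒≢ k₁<k₂ (begin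
        k₁                     ≡⟨ proj₂ (proj₂ (occ k₁)) ⟨
        σ (proj₁ (occ k₁))     ≡⟨ cong σ (toℕ-injective (fromℕ<-injective _ _ _ _ same)) ⟩
        σ (proj₁ (occ k₂))     ≡⟨ proj₂ (proj₂ (occ k₂)) ⟩
        k₂                     ∎)
      where open ≡-Reasoning

    empty-machine : ∃ λ k → ¬ Occupied k
    empty-machine = ¬∀⟶∃¬ m Occupied (λ k → any? (λ j → (toℕ j ℕ.<? toℕ J) ×-dec (σ j ≟ᶠ k))) not-all-occupied

  lpt-separates : (∀ j → 0ℚ ≤ p j) → ∀ {i J} → toℕ i ℕ.< toℕ J → toℕ J ℕ.< m → σ i ≡ σ J → p i ≤ 0ℚ
  lpt-separates 0≤p {i} {J} i<J J<m σi≡σJ = begin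
    p i                        ≡⟨ timesBefore-earlier p J i<J ⟨
    timesBefore p J i          ≤⟨ load-≥-one (timesBefore p J) σ (timesBefore-nonNeg p J 0≤p) σi≡σJ ⟩
    loadBefore p σ J (σ J)     ≤⟨ lpt-empty-machine J J<m ⟩
    0ℚ                         ∎
    where open ≤-Reasoning

-- Three jobs on one machine

decBit : ∀ {A : Set} → Dec A → Fin 2
decBit (yes _) = suc zero
decBit (no _)  = zero

decBit-transfer : ∀ {A B : Set} (a? : Dec A) (b? : Dec B) → decBit a? ≡ decBit b? → B → A
decBit-transfer (yes a) _       _  _ = a
decBit-transfer (no _)  (yes _) () _
decBit-transfer (no _)  (no ¬b) _  b = ⊥-elim (¬b b)

NotFirstOnMachine : ∀ {n m} → Schedule n m → Fin n → Set
NotFirstOnMachine τ j = ∃ λ i → i Fin.< j × τ i ≡ τ j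

notFirstOnMachine? : ∀ {n m} (τ : Schedule n m) j → Dec (NotFirstOnMachine τ j)
notFirstOnMachine? τ j = any? (λ i → (i Fin.<? j) ×-dec (τ i ≟ᶠ τ j))

-- Tag each job with its machine and with whether it is not first on that machine.  There are more
-- than 2m jobs but only 2m tags, so two jobs j₁ < j₂ share a tag; j₂ is not first on its machine,
-- hence neither is j₁.
crowded-machine : ∀ {n m} (τ : Schedule n m) → 2 ℕ.* m ℕ.< n →
  ∃[ j₀ ] ∃[ j₁ ] ∃[ j₂ ] j₀ Fin.< j₁ × j₁ Fin.< j₂ × τ j₀ ≡ τ j₁ × τ j₁ ≡ τ j₂
crowded-machine {n} {m} τ 2m<n
  with j₁ , j₂ , j₁<j₂ , same-tag ← pigeonhole (subst (ℕ._< n) (ℕₚ.*-comm 2 m) 2m<n)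
                                      (λ j → combine (τ j) (decBit (notFirstOnMachine? τ j)))
  with τj₁≡τj₂ , same-bit ← combine-injective (τ j₁) _ (τ j₂) _ same-tag
  with j₀ , j₀<j₁ , τj₀≡τj₁ ← decBit-transfer (notFirstOnMachine? τ j₁) (notFirstOnMachine? τ j₂) same-bit
                                  (j₁ , j₁<j₂ , τj₁≡τj₂)
  = j₀ , j₁ , j₂ , j₀<j₁ , j₁<j₂ , τj₀≡τj₁ , τj₁≡τj₂

makespan-≥-three : ∀ {n m} (p : Fin n → ℚ) (τ : Schedule n m) → (∀ j → 0ℚ ≤ p j) → 2 ℕ.* m ℕ.< n →
  ∀ {x} → (∀ j → x ≤ p j) → x + (x + x) ≤ makespan p τ
makespan-≥-three p τ 0≤p 2m<n {x} x≤p with crowded-machine τ 2m<n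
... | j₀ , j₁ , j₂ , j₀<j₁ , j₁<j₂ , τj₀≡τj₁ , τj₁≡τj₂ = begin
  x + (x + x)                ≤⟨ +-mono-≤ (x≤p j₀) (+-mono-≤ (x≤p j₁) (x≤p j₂)) ⟩
  p j₀ + (p j₁ + p j₂)       ≤⟨ load-≥-three p τ 0≤p (Finₚ.<⇒≢ j₀<j₁) (Finₚ.<⇒≢ (Finₚ.<-trans j₀<j₁ j₁<j₂))
                                  (Finₚ.<⇒≢ j₁<j₂) τj₀≡τj₁ refl (sym τj₁≡τj₂) ⟩
  load p τ (τ j₁)            ≤⟨ load≤makespan p τ (τ j₁) ⟩
  makespan p τ               ∎
  where open ≤-Reasoning

-- Instances with 2m + 1 jobs

2*m≡m+m : ∀ m → 2 ℕ.* m ≡ m ℕ.+ m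
2*m≡m+m m = cong (m ℕ.+_) (ℕₚ.+-identityʳ m)

∸-suc-involutive : ∀ {j T} → j ℕ.< T → T ℕ.∸ suc (T ℕ.∸ suc j) ≡ j
∸-suc-involutive {T = suc T} (ℕ.s≤s j≤T) = ℕₚ.m∸[m∸n]≡n j≤T

module Jobs (k : ℕ) where

  m : ℕ
  m = suc k

  toℕ-jobLow : ∀ i → toℕ (jobLow m i) ≡ toℕ i
  toℕ-jobLow i = toℕ-inject≤ i _

  toℕ-jobHigh : ∀ i → toℕ (jobHigh m i) ≡ 2 ℕ.* m ℕ.∸ suc (toℕ i)
  toℕ-jobHigh i = trans (toℕ-inject₁ (opposite i′))
    (trans (opposite-prop i′) (cong (λ t → 2 ℕ.* m ℕ.∸ suc t) (toℕ-inject≤ i _)))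
    where
    i′ : Fin (2 ℕ.* m)
    i′ = Fin.inject≤ i (ℕₚ.m≤m+n m (m ℕ.+ 0))

  toℕ-jobM : toℕ (jobM m) ≡ k
  toℕ-jobM = trans (toℕ-jobLow (fromℕ k)) (toℕ-fromℕ k)

  jobLow<jobLast : ∀ i → toℕ (jobLow m i) ℕ.< toℕ (jobLast m)
  jobLow<jobLast i = subst₂ ℕ._<_ (sym (toℕ-jobLow i)) (sym (toℕ-fromℕ (2 ℕ.* m)))
    (ℕₚ.<-≤-trans (toℕ<n i) (ℕₚ.m≤m+n m (m ℕ.+ 0)))

  jobHigh<jobLast : ∀ i → toℕ (jobHigh m i) ℕ.< toℕ (jobLast m)
  jobHigh<jobLast i = inject₁<fromℕ _

  m≤jobHigh : ∀ i → m ℕ.≤ toℕ (jobHigh m i)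
  m≤jobHigh i = subst (m ℕ.≤_) (sym (toℕ-jobHigh i))
    (ℕₚ.m+n≤o⇒m≤o∸n m (subst (m ℕ.+ suc (toℕ i) ℕ.≤_) (sym (2*m≡m+m m)) (ℕₚ.+-monoʳ-≤ m (toℕ<n i))))

  jobLow≢jobHigh : ∀ i → jobLow m i ≢ jobHigh m i
  jobLow≢jobHigh i low≡high = ℕₚ.<⇒≱ (subst (ℕ._< m) (sym (toℕ-jobLow i)) (toℕ<n i))
    (subst (m ℕ.≤_) (cong toℕ (sym low≡high)) (m≤jobHigh i))

  jobLow-or-jobHigh : ∀ j → toℕ j ℕ.< 2 ℕ.* m → (∃ λ i → jobLow m i ≡ j) ⊎ (∃ λ i → jobHigh m i ≡ j)
  jobLow-or-jobHigh j j<2m with toℕ j ℕ.<? m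
  ... | yes j<m = inj₁ (fromℕ< j<m , toℕ-injective (trans (toℕ-jobLow _) (toℕ-fromℕ< j<m)))
  ... | no j≮m  = inj₂ (fromℕ< i<m , toℕ-injective (begin
      toℕ (jobHigh m (fromℕ< i<m))              ≡⟨ toℕ-jobHigh (fromℕ< i<m) ⟩
      2 ℕ.* m ℕ.∸ suc (toℕ (fromℕ< i<m))        ≡⟨ cong (λ t → 2 ℕ.* m ℕ.∸ suc t) (toℕ-fromℕ< i<m) ⟩
      2 ℕ.* m ℕ.∸ suc (2 ℕ.* m ℕ.∸ suc (toℕ j)) ≡⟨ ∸-suc-involutive j<2m ⟩
      toℕ j                                     ∎))
    where
    open ≡-Reasoning
    i<m : 2 ℕ.* m ℕ.∸ suc (toℕ j) ℕ.< m
    i<m = ℕₚ.m<n+o⇒m∸n<o (2 ℕ.* m) (suc (toℕ j))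
      (subst (ℕ._< suc (toℕ j) ℕ.+ m) (sym (2*m≡m+m m)) (ℕₚ.+-monoˡ-< m (ℕ.s≤s (ℕₚ.≮⇒≥ j≮m))))

module PairedLPT {k : ℕ} (p : Fin (suc (2 ℕ.* suc k)) → ℚ) (0≤p : ∀ j → 0ℚ ≤ p j)
  (antitone : ∀ i j → toℕ i ℕ.≤ toℕ j → p j ≤ p i)
  (σ : Schedule (suc (2 ℕ.* suc k)) (suc k)) (lpt : IsLPT p σ)
  (paired : ∀ i → σ (jobLow (suc k) i) ≡ σ (jobHigh (suc k) i)) where

  open Jobs k

  startLast : ℚ
  startLast = loadBefore p σ (jobLast m) (σ (jobLast m))

  before : Fin (suc (2 ℕ.* m)) → ℚ
  before = timesBefore p (jobLast m)

  jobLast-smallest : ∀ j → p (jobLast m) ≤ p j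
  jobLast-smallest j = antitone j (jobLast m)
    (subst (toℕ j ℕ.≤_) (sym (toℕ-fromℕ (2 ℕ.* m))) (ℕₚ.≤-pred (toℕ<n j)))

  pair≤loadBefore : ∀ q → p (jobLow m q) + p (jobHigh m q) ≤ loadBefore p σ (jobLast m) (σ (jobLow m q))
  pair≤loadBefore q = ≤-trans
    (≤-reflexive (sym (cong₂ _+_ (timesBefore-earlier p (jobLast m) (jobLow<jobLast q))
                                 (timesBefore-earlier p (jobLast m) (jobHigh<jobLast q)))))
    (load-≥-two before σ (timesBefore-nonNeg p (jobLast m) 0≤p) (jobLow≢jobHigh q) refl (sym (paired q)))

  module _ (jobM-pos : 0ℚ < p (jobM m)) where

    jobLow-pos : ∀ i → 0ℚ < p (jobLow m i)
    jobLow-pos i = <-≤-trans jobM-pos (antitone (jobLow m i) (jobM m)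
      (subst₂ ℕ._≤_ (sym (toℕ-jobLow i)) (sym toℕ-jobM) (ℕₚ.≤-pred (toℕ<n i))))

    earlier-jobLow-alone : ∀ {i q} → i Fin.< q → σ (jobLow m i) ≢ σ (jobLow m q)
    earlier-jobLow-alone {i} {q} i<q σi≡σq = <-irrefl refl (<-≤-trans (jobLow-pos i) (lpt-separates p σ lpt 0≤p
      (subst₂ ℕ._<_ (sym (toℕ-jobLow i)) (sym (toℕ-jobLow q)) i<q)
      (subst (ℕ._< m) (sym (toℕ-jobLow q)) (toℕ<n q)) σi≡σq))

    jobLow-machines-distinct : ∀ {i q} → σ (jobLow m i) ≡ σ (jobLow m q) → i ≡ q
    jobLow-machines-distinct {i} {q} σi≡σq with Finₚ.<-cmp i q
    ... | tri< i<q _ _ = ⊥-elim (earlier-jobLow-alone i<q σi≡σq)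
    ... | tri≈ _ i≡q _ = i≡q
    ... | tri> _ _ q<i = ⊥-elim (earlier-jobLow-alone q<i (sym σi≡σq))

    loadBefore-jobLow-machine : ∀ q →
      loadBefore p σ (jobLast m) (σ (jobLow m q)) ≡ p (jobLow m q) + p (jobHigh m q)
    loadBefore-jobLow-machine q = trans (load-≡-two before σ (jobLow≢jobHigh q) refl (sym (paired q)) others)
      (cong₂ _+_ (timesBefore-earlier p (jobLast m) (jobLow<jobLast q))
                 (timesBefore-earlier p (jobLast m) (jobHigh<jobLast q)))
      where
      others : ∀ l → l ≢ jobLow m q → l ≢ jobHigh m q → σ l ≡ σ (jobLow m q) → before l ≡ 0ℚ
      others l l≢low l≢high σl≡σq = timesBefore-later p (jobLast m) not-earlier
        where
        not-earlier : ¬ toℕ l ℕ.< toℕ (jobLast m)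
        not-earlier l<last with jobLow-or-jobHigh l (subst (toℕ l ℕ.<_) (toℕ-fromℕ (2 ℕ.* m)) l<last)
        ... | inj₁ (i , low≡l) =
          l≢low (trans (sym low≡l) (cong (jobLow m) (jobLow-machines-distinct (trans (cong σ low≡l) σl≡σq))))
        ... | inj₂ (i , high≡l) =
          l≢high (trans (sym high≡l) (cong (jobHigh m) (jobLow-machines-distinct
            (trans (paired i) (trans (cong σ high≡l) σl≡σq)))))

    startLast≤2jobM : startLast ≤ p (jobM m) + p (jobM m)
    startLast≤2jobM = begin
      startLast                                 ≤⟨ lpt (jobLast m) (σ (jobM m)) ⟩
      loadBefore p σ (jobLast m) (σ (jobM m))   ≡⟨ loadBefore-jobLow-machine (fromℕ k) ⟩
      p (jobM m) + p (jobHigh m (fromℕ k))      ≤⟨ +-monoʳ-≤ (p (jobM m)) (antitone (jobM m) _ jobM≤high) ⟩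
      p (jobM m) + p (jobM m)                   ∎
      where
      open ≤-Reasoning
      jobM≤high : toℕ (jobM m) ℕ.≤ toℕ (jobHigh m (fromℕ k))
      jobM≤high = subst (ℕ._≤ toℕ (jobHigh m (fromℕ k))) (sym toℕ-jobM)
        (ℕₚ.≤-trans (ℕₚ.n≤1+n k) (m≤jobHigh (fromℕ k)))

    paired-bound-pos : p (jobLast m) < p (job1 m) - p (jobM m) → (τ : Schedule (suc (2 ℕ.* m)) m) →
      (toℚ m + toℚ k) * startLast + toℚ 6 * p (jobLast m) ≤ toℚ 2 * (toℚ m * makespan p τ)
    paired-bound-pos small τ = begin
      (toℚ m + toℚ k) * L + toℚ 6 * x
        ≡⟨ solve 3 (λ K L x → (con 1ℚ :+ K :+ K) :* L :+ con (toℚ 6) :* x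
             := (L :+ (x :+ x)) :+ con (toℚ 2) :* (x :+ (K :* L :+ x))) refl K L x ⟩
      (L + (x + x)) + toℚ 2 * (x + (K * L + x))
        ≤⟨ +-mono-≤ L+2x≤2a
             (*-monoˡ-≤-nonNeg (toℚ 2) (+-monoˡ-≤ (K * L + x) (jobLast-smallest (jobHigh m zero)))) ⟩
      (a + a) + toℚ 2 * (y + (K * L + x))
        ≡⟨ solve 5 (λ K L x a y → (a :+ a) :+ con (toℚ 2) :* (y :+ (K :* L :+ x))
             := con (toℚ 2) :* ((a :+ y) :+ K :* L :+ x)) refl K L x a y ⟩
      toℚ 2 * ((a + y) + K * L + x)
        ≤⟨ *-monoˡ-≤-nonNeg (toℚ 2) (+-monoˡ-≤ x (+-monoˡ-≤ (K * L) (pair≤loadBefore zero))) ⟩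
      toℚ 2 * (loadBefore p σ (jobLast m) (σ (job1 m)) + K * L + x)
        ≤⟨ *-monoˡ-≤-nonNeg (toℚ 2) (+-monoˡ-≤ x (∑-≥-at+const (lpt (jobLast m)) (σ (job1 m)))) ⟩
      toℚ 2 * (∑ (loadBefore p σ (jobLast m)) + x)
        ≤⟨ *-monoˡ-≤-nonNeg (toℚ 2) (total-work p σ τ) ⟩
      toℚ 2 * (toℚ m * makespan p τ) ∎
      where
      open ≤-Reasoning
      K L x a y b : ℚ
      K = toℚ k
      L = startLast
      x = p (jobLast m)
      a = p (job1 m)
      y = p (jobHigh m zero)
      b = p (jobM m)

      x+b≤a : x + b ≤ a
      x+b≤a = begin
        x + b       ≤⟨ +-monoˡ-≤ b (<⇒≤ small) ⟩
        a - b + b   ≡⟨ solve 2 (λ a b → a :- b :+ b := a) refl a b ⟩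
        a           ∎

      L+2x≤2a : L + (x + x) ≤ a + a
      L+2x≤2a = begin
        L + (x + x)         ≤⟨ +-monoˡ-≤ (x + x) startLast≤2jobM ⟩
        (b + b) + (x + x)   ≡⟨ solve 2 (λ x b → (b :+ b) :+ (x :+ x) := (x :+ b) :+ (x :+ b)) refl x b ⟩
        (x + b) + (x + b)   ≤⟨ +-mono-≤ x+b≤a x+b≤a ⟩
        a + a               ∎

  paired-bound-zero : p (jobM m) ≤ 0ℚ → (τ : Schedule (suc (2 ℕ.* m)) m) →
    (toℚ m + toℚ k) * startLast + toℚ 6 * p (jobLast m) ≤ toℚ 2 * (toℚ m * makespan p τ)
  paired-bound-zero jobM≤0 τ = begin
    (M + K) * L + toℚ 6 * x
      ≤⟨ +-mono-≤ (*-monoˡ-≤-nonNeg (M + K) {{nonNegative 0≤M+K}} L≤C) (*-monoˡ-≤-nonNeg (toℚ 6) x≤0) ⟩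
    (M + K) * C + toℚ 6 * 0ℚ
      ≤⟨ +-monoʳ-≤ ((M + K) * C) (≤-trans (≤-reflexive (*-zeroʳ (toℚ 6))) (makespan-nonNeg p τ 0≤p)) ⟩
    (M + K) * C + C
      ≡⟨ solve 2 (λ K C → (con 1ℚ :+ K :+ K) :* C :+ C := con (toℚ 2) :* ((con 1ℚ :+ K) :* C)) refl K C ⟩
    toℚ 2 * (M * C) ∎
    where
    open ≤-Reasoning
    M K L x C : ℚ
    M = toℚ m
    K = toℚ k
    L = startLast
    x = p (jobLast m)
    C = makespan p τ

    x≤0 : x ≤ 0ℚ
    x≤0 = ≤-trans (jobLast-smallest (jobM m)) jobM≤0

    0≤M+K : 0ℚ ≤ M + K
    0≤M+K = +-mono-≤ (toℚ-nonNeg m) (toℚ-nonNeg k)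

    L≤C : L ≤ C
    L≤C = *-cancelˡ-≤-pos M {{positive (toℚ-suc-pos k)}} (begin
      M * L       ≡⟨ +-identityʳ (M * L) ⟨
      M * L + 0ℚ  ≤⟨ +-monoʳ-≤ (M * L) (0≤p (jobLast m)) ⟩
      M * L + x   ≤⟨ lpt-average p σ lpt τ ⟩
      M * C       ∎)

  paired-bound : p (jobLast m) < p (job1 m) - p (jobM m) → (τ : Schedule (suc (2 ℕ.* m)) m) →
    (toℚ m + toℚ k) * startLast + toℚ 6 * p (jobLast m) ≤ toℚ 2 * (toℚ m * makespan p τ)
  paired-bound small with 0ℚ <? p (jobM m)
  ... | yes jobM-pos = paired-bound-pos jobM-pos small
  ... | no jobM≯0    = paired-bound-zero (≮⇒≥ jobM≯0)

ratio-3 : ∀ {K L x C} → K ≡ toℚ 2 →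
  (1ℚ + K) * L + x ≤ (1ℚ + K) * C → ((1ℚ + K) + K) * L + toℚ 6 * x ≤ toℚ 2 * ((1ℚ + K) * C) →
  L + x ≤ (+ 15 / 13) * C
ratio-3 {L = L} {x} {C} refl average paired = *-cancelˡ-≤-pos (toℚ 13) (begin
  toℚ 13 * (L + x)
    ≡⟨ solve 2 (λ L x → con (toℚ 13) :* (L :+ x)
         := con (toℚ 2) :* ((con (toℚ 3) :+ con (toℚ 2)) :* L :+ con (toℚ 6) :* x)
            :+ (con (toℚ 3) :* L :+ x)) refl L x ⟩
  toℚ 2 * ((toℚ 3 + toℚ 2) * L + toℚ 6 * x) + (toℚ 3 * L + x)
    ≤⟨ +-mono-≤ (*-monoˡ-≤-nonNeg (toℚ 2) paired) average ⟩
  toℚ 2 * (toℚ 2 * (toℚ 3 * C)) + toℚ 3 * C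
    ≡⟨ solve 1 (λ C → con (toℚ 2) :* (con (toℚ 2) :* (con (toℚ 3) :* C)) :+ con (toℚ 3) :* C
         := con (toℚ 13) :* (con (+ 15 / 13) :* C)) refl C ⟩
  toℚ 13 * ((+ 15 / 13) * C) ∎)
  where open ≤-Reasoning

ratio-large : ∀ {K L x C r} → toℚ 3 ≤ K → 0ℚ < (1ℚ + K) + K → r * ((1ℚ + K) + K) ≡ 1ℚ →
  ((1ℚ + K) + K) * L + toℚ 6 * x ≤ toℚ 2 * ((1ℚ + K) * C) → x + (x + x) ≤ C →
  L + x ≤ (+ 4 / 3 - r) * C
ratio-large {K} {L} {x} {C} {r} 3≤K 0<D rD≡1 paired three =
  *-cancelˡ-≤-pos D {{positive 0<D}} (*-cancelˡ-≤-pos (toℚ 3) (begin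
  toℚ 3 * (D * (L + x))
    ≡⟨ solve 3 (λ K L x → con (toℚ 3) :* ((con 1ℚ :+ K :+ K) :* (L :+ x))
         := con (toℚ 3) :* ((con 1ℚ :+ K :+ K) :* L :+ con (toℚ 6) :* x)
            :+ (K :- con (toℚ 3)) :* (con (toℚ 2) :* (x :+ (x :+ x))) :+ (x :+ (x :+ x))) refl K L x ⟩
  toℚ 3 * (D * L + toℚ 6 * x) + (K - toℚ 3) * (toℚ 2 * (x + (x + x))) + (x + (x + x))
    ≤⟨ +-mono-≤ (+-mono-≤ (*-monoˡ-≤-nonNeg (toℚ 3) paired)
                          (*-monoˡ-≤-nonNeg (K - toℚ 3) {{nonNegative 0≤K-3}}
                             (*-monoˡ-≤-nonNeg (toℚ 2) three)))
                three ⟩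
  toℚ 3 * (toℚ 2 * ((1ℚ + K) * C)) + (K - toℚ 3) * (toℚ 2 * C) + C
    ≡⟨ solve 2 (λ K C → con (toℚ 3) :* (con (toℚ 2) :* ((con 1ℚ :+ K) :* C))
                        :+ (K :- con (toℚ 3)) :* (con (toℚ 2) :* C) :+ C
         := (con (toℚ 4) :* (con 1ℚ :+ K :+ K) :- con (toℚ 3)) :* C) refl K C ⟩
  (toℚ 4 * D - toℚ 3) * C
    ≡⟨ cong (λ t → (toℚ 4 * D - toℚ 3 * t) * C) rD≡1 ⟨
  (toℚ 4 * D - toℚ 3 * (r * D)) * C
    ≡⟨ solve 3 (λ C r D → (con (toℚ 4) :* D :- con (toℚ 3) :* (r :* D)) :* C
         := con (toℚ 3) :* (D :* ((con (+ 4 / 3) :- r) :* C))) refl C r D ⟩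
  toℚ 3 * (D * ((+ 4 / 3 - r) * C)) ∎))
  where
  open ≤-Reasoning
  D : ℚ
  D = (1ℚ + K) + K
  0≤K-3 : 0ℚ ≤ K - toℚ 3
  0≤K-3 = ≤-trans (≤-reflexive (sym (+-inverseʳ (toℚ 3)))) (+-monoˡ-≤ (- toℚ 3) 3≤K)

proposition13 : (m : ℕ) → 3 ℕ.≤ m →
    (p : Fin (suc (2 ℕ.* m)) → ℚ) →
    (∀ j → 0ℚ ≤ p j) →
    (∀ i j → toℕ i ℕ.≤ toℕ j → p j ≤ p i) →
    (σ : Schedule (suc (2 ℕ.* m)) m) →
    IsLPT p σ →
    (∀ (i : Fin m) → σ (jobLow m i) ≡ σ (jobHigh m i)) →
    load p σ (σ (jobLast m)) ≡ makespan p σ →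
    p (jobLast m) < p (job1 m) - p (jobM m) →
    (m ≡ 3 → (τ : Schedule (suc (2 ℕ.* m)) m) → makespan p σ ≤ (+ 15 / 13) * makespan p τ)
    × (4 ℕ.≤ m → (τ : Schedule (suc (2 ℕ.* m)) m) → makespan p σ ≤ boundLarge m * makespan p τ)
proposition13 (suc k) _ p 0≤p antitone σ lpt paired critical small = bound-3 , bound-large
  where
  open PairedLPT p 0≤p antitone σ lpt paired

  makespan≡ : makespan p σ ≡ startLast + p (jobLast (suc k))
  makespan≡ = trans (sym critical) (load-lastMachine p σ)

  bound-3 : suc k ≡ 3 → (τ : Schedule (suc (2 ℕ.* suc k)) (suc k)) → makespan p σ ≤ (+ 15 / 13) * makespan p τ
  bound-3 m≡3 τ = subst (_≤ (+ 15 / 13) * makespan p τ) (sym makespan≡)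
    (ratio-3 (cong (toℚ ∘ ℕ.pred) m≡3) (lpt-average p σ lpt τ) (paired-bound small τ))

  D≡ : toℚ (suc (2 ℕ.* k)) ≡ (1ℚ + toℚ k) + toℚ k
  D≡ = trans (toℚ-+ (suc k) (k ℕ.+ 0)) (cong (λ t → toℚ (suc k) + toℚ t) (ℕₚ.+-identityʳ k))

  bound-large : 4 ℕ.≤ suc k → (τ : Schedule (suc (2 ℕ.* suc k)) (suc k)) →
                makespan p σ ≤ boundLarge (suc k) * makespan p τ
  bound-large 4≤m τ = subst (_≤ boundLarge (suc k) * makespan p τ) (sym makespan≡)
    (ratio-large {r = + 1 / suc (2 ℕ.* k)} (toℚ-mono-≤ (ℕₚ.≤-pred 4≤m))
      (subst (0ℚ <_) D≡ (toℚ-suc-pos (2 ℕ.* k)))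
      (subst (λ D → (+ 1 / suc (2 ℕ.* k)) * D ≡ 1ℚ) D≡ (toℚ-suc-reciprocal (2 ℕ.* k)))
      (paired-bound small τ)
      (makespan-≥-three p τ 0≤p (ℕₚ.n<1+n _) jobLast-smallest))
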